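{- Let $G=(V,E)$, $n,m$, $t$ and $\mathcal{M}=\mathcal{M}(G)$ be as in the context. Let $\mathcal{V}$ be an $n$-element subset of the column index set of $\mathcal{M}$ and let $S$ be the submatrix of $\mathcal{M}$ formed by the columns with indexes in $\mathcal{V}$. If there is $v\in V$ such that $\mathcal{V}$ is disjoint from $E\cup\{v^1,v^2,v^3\}$, then $\min_{A}\|\mathcal{M}-SA\|>\sqrt{mt^2+4nt^6+mt^{10}}$, where $A$ ranges over real $n\times(3n+m)$ matrices.
   Context: $G=(V,E)$ is a simple graph with $n=|V|\geqslant1$ vertices and $m=|E|\geqslant1$ edges; $\|\cdot\|$ is the Frobenius norm. Set $t=\frac{1}{4(m+n)^3}$. For $i\in\{1,2,3\}$ let $V^i=\{v^i: v\in V\}$ be a disjoint copy of $V$. The matrix $\mathcal{M}$ has rows indexed by $V\cup\{1,2,3\}\cup\{\varepsilon\}$ and columns indexed by $V^1\cup V^2\cup V^3\cup E$, with entries, for all distinct $u,v\in V$, distinct $i,j\in\{1,2,3\}$, and $e\in E$: $\mathcal{M}(u,u^i)=1$, $\mathcal{M}(u,v^i)=0$; $\mathcal{M}(u,e)=t^2$ if $u\in e$ and $0$ otherwise; $\mathcal{M}(i,v^i)=t^3$, $\mathcal{M}(i,v^j)=0$, $\mathcal{M}(i,e)=t^5$; $\mathcal{M}(\varepsilon,v^i)=0$, $\mathcal{M}(\varepsilon,e)=t$.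
   Formalization: The matrix A ranges over rational n×(3n+m) matrices rather than real ones. -}

module Defs where

open import Data.Nat as ℕ using (ℕ; zero; suc)
open import Data.Fin using (Fin; zero; suc; _<_; _≟_)
open import Data.Product using (_×_; _,_; proj₁; proj₂)
open import Data.Sum using (_⊎_; inj₁; inj₂)
open import Data.Unit using (⊤; tt)
open import Data.Rational using (ℚ; 0ℚ; 1ℚ; _+_; _*_; _-_; _/_)
open import Data.Integer using (+_)
open import Relation.Nullary using (yes; no)
open import Relation.Binary.PropositionalEquality using (_≡_)

Σ[_] : (k : ℕ) → (Fin k → ℚ) → ℚ
Σ[ zero ] f = 0ℚ
Σ[ suc k ] f = f zero + Σ[ k ] (λ i → f (suc i))

record SimpleGraph (n m : ℕ) : Set where
  field
    edge    : Fin m → Fin n × Fin n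
    ordered : ∀ k → proj₁ (edge k) < proj₂ (edge k)
    inj     : ∀ k l → edge k ≡ edge l → k ≡ l
open SimpleGraph public

-- t = 1 / (4 (m+n)^3)   (m ≥ 1 is assumed in the theorem; value at m = 0 irrelevant)
t : ℕ → ℕ → ℚ
t n zero = 0ℚ
t n (suc k) = + 1 / (4 ℕ.* ((suc k ℕ.+ n) ℕ.^ 3))

_^ᵠ_ : ℚ → ℕ → ℚ
x ^ᵠ zero = 1ℚ
x ^ᵠ suc k = x * (x ^ᵠ k)

-- Row indices: V ∪ {1,2,3} ∪ {ε}
Row : ℕ → Set
Row n = Fin n ⊎ (Fin 3 ⊎ ⊤)

-- Column indices: V¹ ∪ V² ∪ V³ ∪ E ; inj₁ (i , v) is v^i
Col : ℕ → ℕ → Set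
Col n m = (Fin 3 × Fin n) ⊎ Fin m

incid : ∀ {n} → Fin n × Fin n → Fin n → ℚ
incid (a , b) u with u ≟ a | u ≟ b
... | yes _ | _ = 1ℚ
... | no _ | yes _ = 1ℚ
... | no _ | no _ = 0ℚ

𝓜 : ∀ {n m} → SimpleGraph n m → Row n → Col n m → ℚ
𝓜 {n} {m} G (inj₁ u) (inj₁ (i , v)) with u ≟ v
... | yes _ = 1ℚ
... | no _ = 0ℚ
𝓜 {n} {m} G (inj₁ u) (inj₂ e) = (t n m ^ᵠ 2) * incid (edge G e) u
𝓜 {n} {m} G (inj₂ (inj₁ i)) (inj₁ (j , v)) with i ≟ j
... | yes _ = t n m ^ᵠ 3
... | no _ = 0ℚ
𝓜 {n} {m} G (inj₂ (inj₁ i)) (inj₂ e) = t n m ^ᵠ 5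
𝓜 {n} {m} G (inj₂ (inj₂ tt)) (inj₁ _) = 0ℚ
𝓜 {n} {m} G (inj₂ (inj₂ tt)) (inj₂ e) = t n m

-- Squared Frobenius norm ‖𝓜 − S A‖², where S is the submatrix of 𝓜 given
-- by the columns c 0, …, c (n-1), and A is a real (here rational) matrix
-- with rows indexed by those n columns and columns indexed by Col n m.
residual² : ∀ {n m} → SimpleGraph n m → (Fin n → Col n m) → (Fin n → Col n m → ℚ) → ℚ
residual² {n} {m} G c A = Σ[ n ] (λ u → rowSum (inj₁ u))
                        + (Σ[ 3 ] (λ i → rowSum (inj₂ (inj₁ i))) + rowSum (inj₂ (inj₂ tt)))
  where
  entry : Row n → Col n m → ℚ
  entry r col = 𝓜 G r col - Σ[ n ] (λ k → 𝓜 G r (c k) * A k col)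
  sq : ℚ → ℚ
  sq x = x * x
  rowSum : Row n → ℚ
  rowSum r = Σ[ 3 ] (λ i → Σ[ n ] (λ v → sq (entry r (inj₁ (i , v)))))
           + Σ[ m ] (λ e → sq (entry r (inj₂ e)))

-- Every column picked by c vanishes in row v, since the nonzero entries of that row sit in the
-- columns E ∪ {v¹, v², v³}. Hence the (v, v¹) entry of 𝓜 − SA is 1 whatever A is, and the
-- squared residual is at least 1. On the other side, each of m t², 4n t⁶, m t¹⁰ is at most t,
-- because m t and 4n t are at most 4(m+n)³ t = 1; and t ≤ 1/4, so their sum is below 1.

{-# OPTIONS --safe #-}
module Submission where

open import Defs
open import Data.Nat as ℕ using (ℕ; zero; suc)
open import Data.Fin using (Fin)
open import Data.Product using (_×_; _,_; ∃)
open import Data.Sum using (inj₁; inj₂)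
open import Data.Rational using (ℚ; _+_; _*_; _<_)
open import Data.Rational using (_/_)
open import Data.Integer using (+_)
open import Function.Definitions using (Injective)
open import Relation.Binary.PropositionalEquality using (_≡_; _≢_)

open import Data.Fin using (zero; suc)
open import Data.Rational using (mkℚ; 0ℚ; 1ℚ; _-_; _≤_; *≤*; *<*; nonNegative; nonPositive)
open import Data.Rational.Properties
open import Relation.Binary.PropositionalEquality using (refl; sym; trans; cong; cong₂; module ≡-Reasoning)
open import Data.Unit using (tt)
open import Relation.Nullary using (yes; no; contradiction)
import Data.Fin as Fin
import Data.Nat.Properties as ℕ
import Data.Nat.Coprimality as Coprime
import Data.Integer as ℤ
import Data.Integer.Properties as ℤ

p≤p+q : ∀ p {q} → 0ℚ ≤ q → p ≤ p + q
p≤p+q p {q} 0≤q = ≤-trans (≤-reflexive (sym (+-identityʳ p))) (+-monoʳ-≤ p 0≤q)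

q≤p+q : ∀ {p} q → 0ℚ ≤ p → q ≤ p + q
q≤p+q {p} q 0≤p = ≤-trans (≤-reflexive (sym (+-identityˡ q))) (+-monoˡ-≤ q 0≤p)

square-nonNeg : ∀ p → 0ℚ ≤ p * p
square-nonNeg p with ≤-total 0ℚ p
... | inj₁ 0≤p = ≤-trans (≤-reflexive (sym (*-zeroʳ p))) (*-monoˡ-≤-nonNeg p {{nonNegative 0≤p}} 0≤p)
... | inj₂ p≤0 = ≤-trans (≤-reflexive (sym (*-zeroˡ p))) (*-monoʳ-≤-nonPos p {{nonPositive p≤0}} p≤0)

Σ-nonNeg : ∀ k {f : Fin k → ℚ} → (∀ i → 0ℚ ≤ f i) → 0ℚ ≤ Σ[ k ] f
Σ-nonNeg zero    0≤f = ≤-refl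
Σ-nonNeg (suc k) 0≤f = +-mono-≤ (0≤f zero) (Σ-nonNeg k (λ i → 0≤f (suc i)))

Σ-≡0 : ∀ k {f : Fin k → ℚ} → (∀ i → f i ≡ 0ℚ) → Σ[ k ] f ≡ 0ℚ
Σ-≡0 zero    f≡0 = refl
Σ-≡0 (suc k) f≡0 = cong₂ _+_ (f≡0 zero) (Σ-≡0 k (λ i → f≡0 (suc i)))

term≤Σ : ∀ k {f : Fin k → ℚ} → (∀ i → 0ℚ ≤ f i) → ∀ j → f j ≤ Σ[ k ] f
term≤Σ (suc k) 0≤f zero    = p≤p+q _ (Σ-nonNeg k (λ i → 0≤f (suc i)))
term≤Σ (suc k) 0≤f (suc j) = ≤-trans (term≤Σ k (λ i → 0≤f (suc i)) j) (q≤p+q _ (0≤f zero))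

ι : ℕ → ℚ
ι a = + a / 1

ι≡mkℚ : ∀ a → ι a ≡ mkℚ (+ a) 0 (Coprime.sym (Coprime.1-coprimeTo a))
ι≡mkℚ a = normalize-coprime _

1/suc≡mkℚ : ∀ d → + 1 / suc d ≡ mkℚ (+ 1) d (Coprime.1-coprimeTo (suc d))
1/suc≡mkℚ d = normalize-coprime _

/-nonNeg : ∀ a d .{{_ : ℕ.NonZero d}} → 0ℚ ≤ + a / d
/-nonNeg a d = nonNegative⁻¹ _ {{normalize-nonNeg a d}}

ι-mono-≤ : ∀ {a b} → a ℕ.≤ b → ι a ≤ ι b
ι-mono-≤ {a} {b} a≤b rewrite ι≡mkℚ a | ι≡mkℚ b = *≤* (ℤ.*-monoʳ-≤-nonNeg (+ 1) (ℤ.+≤+ a≤b))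

n/1*1/n≡1 : ∀ d .{{_ : ℕ.NonZero d}} → ι d * (+ 1 / d) ≡ 1ℚ
n/1*1/n≡1 (suc d) rewrite ι≡mkℚ (suc d) | 1/suc≡mkℚ d =
  *-inverseʳ (mkℚ (+ suc d) 0 (Coprime.sym (Coprime.1-coprimeTo (suc d))))

ι*1/n≤1 : ∀ a d .{{_ : ℕ.NonZero d}} → a ℕ.≤ d → ι a * (+ 1 / d) ≤ 1ℚ
ι*1/n≤1 a d a≤d = ≤-trans (*-monoʳ-≤-nonNeg (+ 1 / d) {{nonNegative (/-nonNeg 1 d)}} (ι-mono-≤ a≤d))
                        (≤-reflexive (n/1*1/n≡1 d))

1/-antimono-≤ : ∀ a d .{{_ : ℕ.NonZero a}} .{{_ : ℕ.NonZero d}} → a ℕ.≤ d → + 1 / d ≤ + 1 / a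
1/-antimono-≤ a d a≤d = begin
  + 1 / d                      ≡⟨ *-identityˡ (+ 1 / d) ⟨
  1ℚ * (+ 1 / d)               ≡⟨ cong (_* (+ 1 / d)) (trans (sym (n/1*1/n≡1 a)) (*-comm (ι a) (+ 1 / a))) ⟩
  (+ 1 / a * ι a) * (+ 1 / d)  ≡⟨ *-assoc (+ 1 / a) (ι a) (+ 1 / d) ⟩
  + 1 / a * (ι a * (+ 1 / d))  ≤⟨ *-monoˡ-≤-nonNeg (+ 1 / a) {{nonNegative (/-nonNeg 1 a)}} (ι*1/n≤1 a d a≤d) ⟩
  + 1 / a * 1ℚ                 ≡⟨ *-identityʳ (+ 1 / a) ⟩
  + 1 / a                      ∎
  where open ≤-Reasoning

^ᵠ-nonNeg : ∀ {x} → 0ℚ ≤ x → ∀ j → 0ℚ ≤ x ^ᵠ j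
^ᵠ-nonNeg 0≤x zero = nonNegative⁻¹ 1ℚ
^ᵠ-nonNeg {x} 0≤x (suc j) = nonNegative⁻¹ _
  {{nonNeg*nonNeg⇒nonNeg x {{nonNegative 0≤x}} (x ^ᵠ j) {{nonNegative (^ᵠ-nonNeg 0≤x j)}}}}

^ᵠ-≤1 : ∀ {x} → 0ℚ ≤ x → x ≤ 1ℚ → ∀ j → x ^ᵠ j ≤ 1ℚ
^ᵠ-≤1 0≤x x≤1 zero = ≤-refl
^ᵠ-≤1 {x} 0≤x x≤1 (suc j) = begin
  x * (x ^ᵠ j)  ≤⟨ *-monoˡ-≤-nonNeg x {{nonNegative 0≤x}} (^ᵠ-≤1 0≤x x≤1 j) ⟩
  x * 1ℚ        ≡⟨ *-identityʳ x ⟩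
  x             ≤⟨ x≤1 ⟩
  1ℚ            ∎
  where open ≤-Reasoning

*-^ᵠ-≤ : ∀ {x} → 0ℚ ≤ x → x ≤ 1ℚ → ∀ c → c * x ≤ 1ℚ → ∀ j → c * (x ^ᵠ (2 ℕ.+ j)) ≤ x
*-^ᵠ-≤ {x} 0≤x x≤1 c cx≤1 j = begin
  c * (x * (x * (x ^ᵠ j)))  ≡⟨ *-assoc c x (x * (x ^ᵠ j)) ⟨
  (c * x) * (x * (x ^ᵠ j))  ≤⟨ *-monoʳ-≤-nonNeg (x * (x ^ᵠ j)) {{nonNegative (^ᵠ-nonNeg 0≤x (suc j))}} cx≤1 ⟩
  1ℚ * (x * (x ^ᵠ j))       ≡⟨ *-identityˡ (x * (x ^ᵠ j)) ⟩
  x * (x ^ᵠ j)              ≤⟨ *-monoˡ-≤-nonNeg x {{nonNegative 0≤x}} (^ᵠ-≤1 0≤x x≤1 j) ⟩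
  x * 1ℚ                    ≡⟨ *-identityʳ x ⟩
  x                         ∎
  where open ≤-Reasoning

polynomial<1 : ∀ p q {x} → 0ℚ ≤ x → x ≤ + 1 / 4 → p * x ≤ 1ℚ → q * x ≤ 1ℚ →
               p * (x ^ᵠ 2) + q * (x ^ᵠ 6) + p * (x ^ᵠ 10) < 1ℚ
polynomial<1 p q {x} 0≤x x≤¼ px≤1 qx≤1 = begin-strict
  p * (x ^ᵠ 2) + q * (x ^ᵠ 6) + p * (x ^ᵠ 10)  ≤⟨ +-mono-≤ (+-mono-≤ (bound p px≤1 0) (bound q qx≤1 4)) (bound p px≤1 8) ⟩
  x + x + x                                    ≤⟨ +-mono-≤ (+-mono-≤ x≤¼ x≤¼) x≤¼ ⟩
  + 1 / 4 + + 1 / 4 + + 1 / 4                  <⟨ *<* (ℤ.+<+ (ℕ.n<1+n 3)) ⟩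
  1ℚ                                           ∎
  where
  open ≤-Reasoning
  bound : ∀ c → c * x ≤ 1ℚ → ∀ j → c * (x ^ᵠ (2 ℕ.+ j)) ≤ x
  bound = *-^ᵠ-≤ 0≤x (≤-trans x≤¼ (*≤* (ℤ.+≤+ (ℕ.s≤s ℕ.z≤n))))

t-polynomial<1 : ∀ n k → let x = t n (suc k) in
  ι (suc k) * (x ^ᵠ 2) + ι (4 ℕ.* n) * (x ^ᵠ 6) + ι (suc k) * (x ^ᵠ 10) < 1ℚ
t-polynomial<1 n k = polynomial<1 (ι (suc k)) (ι (4 ℕ.* n)) (/-nonNeg 1 d) (1/-antimono-≤ 4 d 4≤d)
                                   (ι*1/n≤1 (suc k) d m≤d) (ι*1/n≤1 (4 ℕ.* n) d 4n≤d)
  where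
  N = suc k ℕ.+ n
  d = 4 ℕ.* N ℕ.^ 3
  4N≤d : 4 ℕ.* N ℕ.≤ d
  4N≤d = ℕ.*-monoʳ-≤ 4 (ℕ.m≤m*n N (N ℕ.^ 2))
  4≤d : 4 ℕ.≤ d
  4≤d = ℕ.≤-trans (ℕ.m≤m*n 4 N) 4N≤d
  m≤d : suc k ℕ.≤ d
  m≤d = ℕ.≤-trans (ℕ.≤-trans (ℕ.m≤m+n (suc k) n) (ℕ.m≤n*m N 4)) 4N≤d
  4n≤d : 4 ℕ.* n ℕ.≤ d
  4n≤d = ℕ.≤-trans (ℕ.*-monoʳ-≤ 4 (ℕ.m≤n+m n (suc k))) 4N≤d

Avoids : ∀ {n m} → Fin n → Col n m → Set
Avoids v col = (∀ e → col ≢ inj₂ e) × (∀ i → col ≢ inj₁ (i , v))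

module _ {n m} (G : SimpleGraph n m) where

  𝓜-diag : ∀ v i → 𝓜 G (inj₁ v) (inj₁ (i , v)) ≡ 1ℚ
  𝓜-diag v i with v Fin.≟ v
  ... | yes _  = refl
  ... | no v≢v = contradiction refl v≢v

  𝓜-avoids : ∀ v col → Avoids v col → 𝓜 G (inj₁ v) col ≡ 0ℚ
  𝓜-avoids v (inj₂ e)       (∉E , _)  = contradiction refl (∉E e)
  𝓜-avoids v (inj₁ (i , w)) (_ , ≢vⁱ) with v Fin.≟ w
  ... | yes refl = contradiction refl (≢vⁱ i)
  ... | no _     = refl

-- The local definitions of residual², restated so that residual² G c A unfolds to sums of rowSum.
module Residual {n m} (G : SimpleGraph n m) (c : Fin n → Col n m) (A : Fin n → Col n m → ℚ) where

  entry : Row n → Col n m → ℚ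
  entry r col = 𝓜 G r col - Σ[ n ] (λ k → 𝓜 G r (c k) * A k col)

  rowSum : Row n → ℚ
  rowSum r = Σ[ 3 ] (λ i → Σ[ n ] (λ v → entry r (inj₁ (i , v)) * entry r (inj₁ (i , v))))
           + Σ[ m ] (λ e → entry r (inj₂ e) * entry r (inj₂ e))

  entry²-nonNeg : ∀ r col → 0ℚ ≤ entry r col * entry r col
  entry²-nonNeg r col = square-nonNeg (entry r col)

  rowSum-nonNeg : ∀ r → 0ℚ ≤ rowSum r
  rowSum-nonNeg r = +-mono-≤ (Σ-nonNeg 3 (λ i → Σ-nonNeg n (λ v → entry²-nonNeg r (inj₁ (i , v)))))
                             (Σ-nonNeg m (λ e → entry²-nonNeg r (inj₂ e)))

  square≤rowSum : ∀ r i v → entry r (inj₁ (i , v)) * entry r (inj₁ (i , v)) ≤ rowSum r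
  square≤rowSum r i v = begin
    entry r (inj₁ (i , v)) * entry r (inj₁ (i , v))
      ≤⟨ term≤Σ n (λ w → entry²-nonNeg r (inj₁ (i , w))) v ⟩
    Σ[ n ] (λ w → entry r (inj₁ (i , w)) * entry r (inj₁ (i , w)))
      ≤⟨ term≤Σ 3 (λ j → Σ-nonNeg n (λ w → entry²-nonNeg r (inj₁ (j , w)))) i ⟩
    Σ[ 3 ] (λ j → Σ[ n ] (λ w → entry r (inj₁ (j , w)) * entry r (inj₁ (j , w))))
      ≤⟨ p≤p+q _ (Σ-nonNeg m (λ e → entry²-nonNeg r (inj₂ e))) ⟩
    rowSum r ∎
    where open ≤-Reasoning

  rowSum≤residual² : ∀ u → rowSum (inj₁ u) ≤ residual² G c A
  rowSum≤residual² u = begin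
    rowSum (inj₁ u)                  ≤⟨ term≤Σ n (λ w → rowSum-nonNeg (inj₁ w)) u ⟩
    Σ[ n ] (λ w → rowSum (inj₁ w))   ≤⟨ p≤p+q _ (+-mono-≤ (Σ-nonNeg 3 (λ i → rowSum-nonNeg (inj₂ (inj₁ i))))
                                                         (rowSum-nonNeg (inj₂ (inj₂ tt)))) ⟩
    residual² G c A                  ∎
    where open ≤-Reasoning

  entry-diag≡1 : ∀ v i → (∀ k → Avoids v (c k)) → entry (inj₁ v) (inj₁ (i , v)) ≡ 1ℚ
  entry-diag≡1 v i avoids = begin
    𝓜 G (inj₁ v) (inj₁ (i , v)) - Σ[ n ] (λ k → 𝓜 G (inj₁ v) (c k) * A k (inj₁ (i , v)))
      ≡⟨ cong₂ _-_ (𝓜-diag G v i) (Σ-≡0 n vanishes) ⟩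
    1ℚ - 0ℚ
      ≡⟨⟩
    1ℚ ∎
    where
    open ≡-Reasoning
    vanishes : ∀ k → 𝓜 G (inj₁ v) (c k) * A k (inj₁ (i , v)) ≡ 0ℚ
    vanishes k = trans (cong (_* A k (inj₁ (i , v))) (𝓜-avoids G v (c k) (avoids k)))
                       (*-zeroˡ (A k (inj₁ (i , v))))

  1≤residual² : ∀ v → (∀ k → Avoids v (c k)) → 1ℚ ≤ residual² G c A
  1≤residual² v avoids = begin
    1ℚ                                                ≡⟨ cong (λ x → x * x) (entry-diag≡1 v zero avoids) ⟨
    entry (inj₁ v) (inj₁ (zero , v)) * entry (inj₁ v) (inj₁ (zero , v))
                                                      ≤⟨ square≤rowSum (inj₁ v) zero v ⟩
    rowSum (inj₁ v)                                   ≤⟨ rowSum≤residual² v ⟩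
    residual² G c A                                   ∎
    where open ≤-Reasoning

lemma4p1 : (n m : ℕ) → 1 ℕ.≤ n → 1 ℕ.≤ m → (G : SimpleGraph n m)
    → (c : Fin n → Col n m) → Injective _≡_ _≡_ c
    → (∃ λ v → ∀ k → (∀ e → c k ≢ inj₂ e) × (∀ i → c k ≢ inj₁ (i , v)))
    → (A : Fin n → Col n m → ℚ)
    → (+ m / 1) * (t n m ^ᵠ 2) + (+ (4 ℕ.* n) / 1) * (t n m ^ᵠ 6) + (+ m / 1) * (t n m ^ᵠ 10)
    < residual² G c A
lemma4p1 _ zero    _ ()
lemma4p1 n (suc k) _ _ G c _ (v , avoids) A =
  <-≤-trans (t-polynomial<1 n k) (Residual.1≤residual² G c A v avoids)
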